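{- For all integers $n\ge 2$ we have $\chi\bigl(G_2(n)\bigr)\le 2\lceil\log_2(n)\rceil-1$.
   Context: $G_2(n)$ is the graph whose vertices are the integer triples $(x_1,x_2,x_3)$ with $1\le x_1\le x_2\le x_3\le n$ and $x_1<x_3$, in which two vertices $\mathbf{x},\mathbf{y}$ are adjacent iff one can write $\mathbf{x}=(x_1,x_2,x_3)$, $\mathbf{y}=(y_1,y_2,y_3)$ (in some order of the two vertices) with $x_1<y_1\le x_3<y_3$, $x_2\le y_1$ and $x_3\le y_2$. -}

module Defs where

open import Data.Nat using (ℕ; _≤_; _<_)
open import Data.Fin using (Fin)
open import Data.Product using (_×_; Σ)
open import Data.Sum using (_⊎_)
open import Relation.Binary.PropositionalEquality using (_≢_)

record Vertex (n : ℕ) : Set where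
  constructor triple
  field
    x₁ x₂ x₃ : ℕ
    1≤x₁ : 1 ≤ x₁
    x₁≤x₂ : x₁ ≤ x₂
    x₂≤x₃ : x₂ ≤ x₃
    x₃≤n : x₃ ≤ n
    x₁<x₃ : x₁ < x₃

open Vertex public

Adj→ : ∀ {n} → Vertex n → Vertex n → Set
Adj→ x y = (x₁ x < x₁ y) × (x₁ y ≤ x₃ x) × (x₃ x < x₃ y)
           × (x₂ x ≤ x₁ y) × (x₃ x ≤ x₂ y)

Adj : ∀ {n} → Vertex n → Vertex n → Set
Adj x y = Adj→ x y ⊎ Adj→ y x

ProperColouring : ℕ → ℕ → Set
ProperColouring n k =
  Σ (Vertex n → Fin k) λ c → ∀ (x y : Vertex n) → Adj x y → c x ≢ c y

χ≤ : ℕ → ℕ → Set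
χ≤ n k = ProperColouring n k

-- Shift coordinates to 0 … n − 1, i.e. to numbers below 2^K with K = ⌈log₂ n⌉.
-- Colour a vertex (x₁, x₂, x₃) by the level i of the highest bit in which x₁ and
-- x₃ differ, together with bit i of x₂.  If x → y is an edge whose ends both split
-- at level i, the interlacing x₁ < y₁ ≤ x₃ < y₃ forces x₁ and y₁ to agree from
-- bit i upwards, and likewise x₃ and y₃; squeezing x₂ between x₁ and y₁ and y₂
-- between x₃ and y₃ then makes bit i of x₂ a 0 and that of y₂ a 1.  At level 0 the
-- same squeeze would give x₁ = y₁, so level 0 carries no edge and one colour
-- suffices there: 1 + 2 (K − 1) colours in all.
module Submission where

open import Defs
open import Data.Nat using (ℕ; _≤_; _*_; _∸_)
open import Data.Nat.Logarithm using (⌈log₂_⌉)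
open import Data.Nat.Base
open import Data.Nat.Properties
open import Data.Nat.DivMod
  using (_/_; _%_; m≡m%n+[m/n]*n; m%n<n; m<n⇒m%n≡m; [m+kn]%n≡m%n;
         /-monoˡ-≤; m<n*o⇒m/o<n)
open import Data.Nat.Logarithm.Core using (⌈log2⌉)
open import Data.Nat.Induction using (<-wellFounded)
open import Induction.WellFounded using (Acc; acc)
open import Data.Fin using (fromℕ<)
open import Data.Fin.Properties using (fromℕ<-injective)
open import Data.Product using (_×_; _,_; proj₁; proj₂; ∃-syntax)
open import Data.Sum using (inj₁; inj₂)
open import Relation.Binary.PropositionalEquality
open import Relation.Nullary using (yes; no)
open import Relation.Nullary.Negation using (contradiction)

n≤2^⌈log2⌉n : ∀ n (rec : Acc _<_ n) → n ≤ 2 ^ ⌈log2⌉ n rec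
n≤2^⌈log2⌉n 0 _ = z≤n
n≤2^⌈log2⌉n 1 _ = s≤s z≤n
n≤2^⌈log2⌉n (suc (suc n)) (acc rs) = begin
  2 + n                         ≡⟨ cong (2 +_) (⌊n/2⌋+⌈n/2⌉≡n n) ⟨
  2 + (⌊ n /2⌋ + ⌈ n /2⌉)       ≤⟨ +-monoʳ-≤ 2 (+-monoˡ-≤ ⌈ n /2⌉ (⌊n/2⌋≤⌈n/2⌉ n)) ⟩
  suc (suc (⌈ n /2⌉ + ⌈ n /2⌉)) ≡⟨ cong suc (+-suc ⌈ n /2⌉ ⌈ n /2⌉) ⟨
  suc ⌈ n /2⌉ + suc ⌈ n /2⌉     ≤⟨ +-mono-≤ ih ih ⟩
  2 ^ r + 2 ^ r                 ≡⟨ cong (2 ^ r +_) (+-identityʳ (2 ^ r)) ⟨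
  2 ^ suc r                     ∎
  where
  open ≤-Reasoning
  r = ⌈log2⌉ (suc ⌈ n /2⌉) (rs (⌈n/2⌉<n n))
  ih : suc ⌈ n /2⌉ ≤ 2 ^ r
  ih = n≤2^⌈log2⌉n (suc ⌈ n /2⌉) (rs (⌈n/2⌉<n n))

n≤2^⌈log₂n⌉ : ∀ n → n ≤ 2 ^ ⌈log₂ n ⌉
n≤2^⌈log₂n⌉ n = n≤2^⌈log2⌉n n (<-wellFounded n)

⌊_/2^_⌋ : ℕ → ℕ → ℕ
⌊ a /2^ zero  ⌋ = a
⌊ a /2^ suc j ⌋ = ⌊ a / 2 /2^ j ⌋

⌊/2^⌋-monoˡ-≤ : ∀ j {a b} → a ≤ b → ⌊ a /2^ j ⌋ ≤ ⌊ b /2^ j ⌋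
⌊/2^⌋-monoˡ-≤ zero    a≤b = a≤b
⌊/2^⌋-monoˡ-≤ (suc j) a≤b = ⌊/2^⌋-monoˡ-≤ j (/-monoˡ-≤ 2 a≤b)

⌊/2^suc⌋≡⌊/2^⌋/2 : ∀ j a → ⌊ a /2^ suc j ⌋ ≡ ⌊ a /2^ j ⌋ / 2
⌊/2^suc⌋≡⌊/2^⌋/2 zero    a = refl
⌊/2^suc⌋≡⌊/2^⌋/2 (suc j) a = ⌊/2^suc⌋≡⌊/2^⌋/2 j (a / 2)

a<2^k⇒⌊a/2^k⌋≡0 : ∀ k {a} → a < 2 ^ k → ⌊ a /2^ k ⌋ ≡ 0
a<2^k⇒⌊a/2^k⌋≡0 zero    (s≤s z≤n) = refl
a<2^k⇒⌊a/2^k⌋≡0 (suc k) {a} a<2^k+1 =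
  a<2^k⇒⌊a/2^k⌋≡0 k (m<n*o⇒m/o<n (subst (a <_) (*-comm 2 (2 ^ k)) a<2^k+1))

SplitAt : ℕ → ℕ → ℕ → Set
SplitAt i a b = ⌊ a /2^ i ⌋ ≢ ⌊ b /2^ i ⌋ × ⌊ a /2^ suc i ⌋ ≡ ⌊ b /2^ suc i ⌋

split-level : ∀ k {a b} → a ≢ b → ⌊ a /2^ k ⌋ ≡ ⌊ b /2^ k ⌋ → ∃[ i ] i < k × SplitAt i a b
split-level zero    a≢b a≡b = contradiction a≡b a≢b
split-level (suc k) {a} {b} a≢b merged with a / 2 ≟ b / 2
... | yes halves≡ = 0 , z<s , a≢b , halves≡
... | no  halves≢ with split-level k halves≢ merged
...   | i , i<k , splits = suc i , s<s i<k , splits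

/2∧%2-injective : ∀ {u v} → u / 2 ≡ v / 2 → u % 2 ≡ v % 2 → u ≡ v
/2∧%2-injective {u} {v} halves≡ parities≡ = begin
  u                 ≡⟨ m≡m%n+[m/n]*n u 2 ⟩
  u % 2 + u / 2 * 2 ≡⟨ cong₂ (λ p h → p + h * 2) parities≡ halves≡ ⟩
  v % 2 + v / 2 * 2 ≡⟨ m≡m%n+[m/n]*n v 2 ⟨
  v                 ∎
  where open ≡-Reasoning

Siblings : ℕ → ℕ → Set
Siblings u v = u < v × u / 2 ≡ v / 2

siblings-parity : ∀ {u v} → Siblings u v → u % 2 ≡ 0 × v % 2 ≡ 1
siblings-parity {u} {v} (u<v , halves≡) = bits (u % 2) (v % 2) parity-< (m%n<n v 2)
  where
  parity-< : u % 2 < v % 2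
  parity-< = +-cancelʳ-< (v / 2 * 2) (u % 2) (v % 2)
    (subst (λ h → u % 2 + h * 2 < v % 2 + v / 2 * 2) halves≡
      (subst₂ _<_ (m≡m%n+[m/n]*n u 2) (m≡m%n+[m/n]*n v 2) u<v))
  bits : ∀ p q → p < q → q < 2 → p ≡ 0 × q ≡ 1
  bits zero    (suc zero) _ _ = refl , refl
  bits (suc _) (suc zero) (s≤s ()) _
  bits _ (suc (suc _)) _ (s≤s (s≤s ()))

sandwiched-siblings : ∀ {p₁ p₃ q₁ q₃} → p₁ ≤ q₁ → q₁ ≤ p₃ →
                      Siblings p₁ p₃ → Siblings q₁ q₃ → p₁ ≡ q₁ × p₃ ≡ q₃
sandwiched-siblings {p₁} {p₃} {q₁} {q₃} p₁≤q₁ q₁≤p₃ p@(_ , p-halves≡) q@(_ , q-halves≡) =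
  /2∧%2-injective p₁q₁-halves≡ (trans (proj₁ p-parity) (sym (proj₁ q-parity))) ,
  /2∧%2-injective (trans (sym p-halves≡) (trans p₁q₁-halves≡ q-halves≡))
                  (trans (proj₂ p-parity) (sym (proj₂ q-parity)))
  where
  p-parity : p₁ % 2 ≡ 0 × p₃ % 2 ≡ 1
  p-parity = siblings-parity p
  q-parity : q₁ % 2 ≡ 0 × q₃ % 2 ≡ 1
  q-parity = siblings-parity q
  p₁q₁-halves≡ : p₁ / 2 ≡ q₁ / 2
  p₁q₁-halves≡ = ≤-antisym (/-monoˡ-≤ 2 p₁≤q₁)
                           (subst (q₁ / 2 ≤_) (sym p-halves≡) (/-monoˡ-≤ 2 q₁≤p₃))

SplitAt⇒Siblings : ∀ i {a b} → a ≤ b → SplitAt i a b → Siblings ⌊ a /2^ i ⌋ ⌊ b /2^ i ⌋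
SplitAt⇒Siblings i {a} {b} a≤b (differ , merge) =
  ≤∧≢⇒< (⌊/2^⌋-monoˡ-≤ i a≤b) differ ,
  trans (sym (⌊/2^suc⌋≡⌊/2^⌋/2 i a)) (trans merge (⌊/2^suc⌋≡⌊/2^⌋/2 i b))

crossing-splits : ∀ {i a₁ a₂ a₃ b₁ b₂ b₃} →
                  a₁ ≤ a₂ → a₂ ≤ b₁ → a₁ < b₁ → b₁ ≤ a₃ → a₃ ≤ b₂ → b₂ ≤ b₃ →
                  SplitAt i a₁ a₃ → SplitAt i b₁ b₃ →
                  0 < i × ⌊ a₂ /2^ i ⌋ % 2 ≡ 0 × ⌊ b₂ /2^ i ⌋ % 2 ≡ 1
crossing-splits {i} {a₁} {a₂} {a₃} {b₁} {b₂} {b₃}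
                a₁≤a₂ a₂≤b₁ a₁<b₁ b₁≤a₃ a₃≤b₂ b₂≤b₃ a-splits b-splits =
  positive i a₁≡b₁ , a₂-even , b₂-odd
  where
  ⌊_⌋ᵢ : ℕ → ℕ
  ⌊ a ⌋ᵢ = ⌊ a /2^ i ⌋
  mono : ∀ {a b} → a ≤ b → ⌊ a ⌋ᵢ ≤ ⌊ b ⌋ᵢ
  mono = ⌊/2^⌋-monoˡ-≤ i
  a-siblings : Siblings ⌊ a₁ ⌋ᵢ ⌊ a₃ ⌋ᵢ
  a-siblings = SplitAt⇒Siblings i (≤-trans (<⇒≤ a₁<b₁) b₁≤a₃) a-splits
  b-siblings : Siblings ⌊ b₁ ⌋ᵢ ⌊ b₃ ⌋ᵢ
  b-siblings = SplitAt⇒Siblings i (≤-trans b₁≤a₃ (≤-trans a₃≤b₂ b₂≤b₃)) b-splits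
  same-blocks : ⌊ a₁ ⌋ᵢ ≡ ⌊ b₁ ⌋ᵢ × ⌊ a₃ ⌋ᵢ ≡ ⌊ b₃ ⌋ᵢ
  same-blocks = sandwiched-siblings (mono (<⇒≤ a₁<b₁)) (mono b₁≤a₃) a-siblings b-siblings
  a₁≡b₁ : ⌊ a₁ ⌋ᵢ ≡ ⌊ b₁ ⌋ᵢ
  a₁≡b₁ = proj₁ same-blocks
  a₃≡b₃ : ⌊ a₃ ⌋ᵢ ≡ ⌊ b₃ ⌋ᵢ
  a₃≡b₃ = proj₂ same-blocks
  a₂≡a₁ : ⌊ a₂ ⌋ᵢ ≡ ⌊ a₁ ⌋ᵢ
  a₂≡a₁ = ≤-antisym (subst (⌊ a₂ ⌋ᵢ ≤_) (sym a₁≡b₁) (mono a₂≤b₁)) (mono a₁≤a₂)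
  b₂≡a₃ : ⌊ b₂ ⌋ᵢ ≡ ⌊ a₃ ⌋ᵢ
  b₂≡a₃ = ≤-antisym (subst (⌊ b₂ ⌋ᵢ ≤_) (sym a₃≡b₃) (mono b₂≤b₃)) (mono a₃≤b₂)
  a₂-even : ⌊ a₂ ⌋ᵢ % 2 ≡ 0
  a₂-even = trans (cong (_% 2) a₂≡a₁) (proj₁ (siblings-parity a-siblings))
  b₂-odd : ⌊ b₂ ⌋ᵢ % 2 ≡ 1
  b₂-odd = trans (cong (_% 2) b₂≡a₃) (proj₂ (siblings-parity a-siblings))
  positive : ∀ j → ⌊ a₁ /2^ j ⌋ ≡ ⌊ b₁ /2^ j ⌋ → 0 < j
  positive zero    eq = contradiction eq (<⇒≢ a₁<b₁)
  positive (suc _) _     = z<s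

colour : ℕ → ℕ → ℕ
colour zero    _ = 0
colour (suc i) b = suc (b + i * 2)

+*2-injective : ∀ {b c i j} → b < 2 → c < 2 → b + i * 2 ≡ c + j * 2 → b ≡ c × i ≡ j
+*2-injective {b} {c} {i} {j} b<2 c<2 eq =
  b≡c , *-cancelʳ-≡ i j 2 (+-cancelˡ-≡ b _ _ (trans eq (cong (_+ j * 2) (sym b≡c))))
  where
  open ≡-Reasoning
  b≡c : b ≡ c
  b≡c = begin
    b               ≡⟨ m<n⇒m%n≡m b<2 ⟨
    b % 2           ≡⟨ [m+kn]%n≡m%n b i 2 ⟨
    (b + i * 2) % 2 ≡⟨ cong (_% 2) eq ⟩
    (c + j * 2) % 2 ≡⟨ [m+kn]%n≡m%n c j 2 ⟩
    c % 2           ≡⟨ m<n⇒m%n≡m c<2 ⟩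
    c               ∎

colour-injective : ∀ {i j b c} → b < 2 → c < 2 → colour i b ≡ colour j c →
                   i ≡ j × (0 < i → b ≡ c)
colour-injective {zero}  {zero}  _   _   _  = refl , λ ()
colour-injective {suc i} {suc j} b<2 c<2 eq with +*2-injective b<2 c<2 (suc-injective eq)
... | b≡c , i≡j = cong suc i≡j , λ _ → b≡c

colour≤*2 : ∀ i {b} → b < 2 → colour i b ≤ i * 2
colour≤*2 zero    _   = z≤n
colour≤*2 (suc i) b<2 = s≤s (+-monoˡ-≤ (i * 2) (s≤s⁻¹ b<2))

m<n⇒m*2<2*n∸1 : ∀ {m n} → m < n → m * 2 < 2 * n ∸ 1
m<n⇒m*2<2*n∸1 {m} {suc n} (s≤s m≤n) =
  subst (m * 2 <_) (cong (_∸ 1) (*-comm (suc n) 2)) (s≤s (*-monoˡ-≤ 2 m≤n))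

pred-<-≤ : ∀ {a N} → 1 ≤ a → a ≤ N → a ∸ 1 < N
pred-<-≤ {suc a} _ a<N = a<N

module _ {n K : ℕ} (n≤2^K : n ≤ 2 ^ K) where

  a₁ a₂ a₃ : Vertex n → ℕ
  a₁ x = x₁ x ∸ 1
  a₂ x = x₂ x ∸ 1
  a₃ x = x₃ x ∸ 1

  a₁<a₃ : ∀ x → a₁ x < a₃ x
  a₁<a₃ x = ∸-monoˡ-< (x₁<x₃ x) (1≤x₁ x)

  a₃<2^K : ∀ x → a₃ x < 2 ^ K
  a₃<2^K x = pred-<-≤ (≤-trans (1≤x₁ x) (<⇒≤ (x₁<x₃ x))) (≤-trans (x₃≤n x) n≤2^K)

  splitting : ∀ x → ∃[ i ] i < K × SplitAt i (a₁ x) (a₃ x)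
  splitting x = split-level K (<⇒≢ (a₁<a₃ x))
    (trans (a<2^k⇒⌊a/2^k⌋≡0 K (<-trans (a₁<a₃ x) (a₃<2^K x)))
           (sym (a<2^k⇒⌊a/2^k⌋≡0 K (a₃<2^K x))))

  level : Vertex n → ℕ
  level x = proj₁ (splitting x)

  level<K : ∀ x → level x < K
  level<K x = proj₁ (proj₂ (splitting x))

  level-splits : ∀ x → SplitAt (level x) (a₁ x) (a₃ x)
  level-splits x = proj₂ (proj₂ (splitting x))

  bit : Vertex n → ℕ
  bit x = ⌊ a₂ x /2^ level x ⌋ % 2

  bit<2 : ∀ x → bit x < 2
  bit<2 x = m%n<n ⌊ a₂ x /2^ level x ⌋ 2

  colourOf : Vertex n → ℕ
  colourOf x = colour (level x) (bit x)

  colourOf< : ∀ x → colourOf x < 2 * K ∸ 1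
  colourOf< x = ≤-<-trans (colour≤*2 (level x) (bit<2 x)) (m<n⇒m*2<2*n∸1 (level<K x))

  Adj→⇒colourOf≢ : ∀ x y → Adj→ x y → colourOf x ≢ colourOf y
  Adj→⇒colourOf≢ x y (x₁<y₁ , y₁≤x₃ , _ , x₂≤y₁ , x₃≤y₂) same
    with colour-injective (bit<2 x) (bit<2 y) same
  ... | level≡ , bit≡ = 0≢1+n (begin
    0                          ≡⟨ proj₁ (proj₂ crossing) ⟨
    bit x                      ≡⟨ bit≡ (proj₁ crossing) ⟩
    bit y                      ≡⟨ cong (λ i → ⌊ a₂ y /2^ i ⌋ % 2) level≡ ⟨
    ⌊ a₂ y /2^ level x ⌋ % 2   ≡⟨ proj₂ (proj₂ crossing) ⟩
    1                          ∎)
    where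
    open ≡-Reasoning
    shift : ∀ {a b} → a ≤ b → a ∸ 1 ≤ b ∸ 1
    shift = ∸-monoˡ-≤ 1
    crossing : 0 < level x × ⌊ a₂ x /2^ level x ⌋ % 2 ≡ 0 × ⌊ a₂ y /2^ level x ⌋ % 2 ≡ 1
    crossing = crossing-splits (shift (x₁≤x₂ x)) (shift x₂≤y₁) (∸-monoˡ-< x₁<y₁ (1≤x₁ x))
                 (shift y₁≤x₃) (shift x₃≤y₂) (shift (x₂≤x₃ y))
                 (level-splits x) (subst (λ i → SplitAt i (a₁ y) (a₃ y)) (sym level≡) (level-splits y))

  colouring : ProperColouring n (2 * K ∸ 1)
  colouring = (λ x → fromℕ< (colourOf< x)) , proper
    where
    same-colourOf : ∀ x y → fromℕ< (colourOf< x) ≡ fromℕ< (colourOf< y) → colourOf x ≡ colourOf y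
    same-colourOf x y = fromℕ<-injective (colourOf x) (colourOf y) (colourOf< x) (colourOf< y)
    proper : ∀ x y → Adj x y → fromℕ< (colourOf< x) ≢ fromℕ< (colourOf< y)
    proper x y (inj₁ x→y) eq = Adj→⇒colourOf≢ x y x→y (same-colourOf x y eq)
    proper x y (inj₂ y→x) eq = Adj→⇒colourOf≢ y x y→x (same-colourOf y x (sym eq))

lemma4p5 : (n : ℕ) → 2 ≤ n → χ≤ n (2 * ⌈log₂ n ⌉ ∸ 1)
lemma4p5 n _ = colouring {K = ⌈log₂ n ⌉} (n≤2^⌈log₂n⌉ n)
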